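{- Let $G$ be a finite simple graph with a closed labeling $V(G)=[n]$. If $i,j\in[n]$, $i\neq j$, are exchangeable, then the labeling obtained by switching the labels $i$ and $j$ (i.e., composing with the transposition of $i$ and $j$) is also closed.
   Context: A labeling of a graph $G$ with $n$ vertices is a bijection $V(G)\to[n]$; given a labeling we identify $V(G)=[n]$. A labeling is closed if whenever $\{j,i\},\{i,k\}\in E(G)$ with $j\neq k$ and either $j>i<k$ or $j<i>k$, then $\{j,k\}\in E(G)$. The full neighborhood of $v$ is $N_G[v]=\{v\}\cup N_G(v)$. Vertices $v,w$ are exchangeable if $N_G[v]=N_G[w]$. -}

module Defs where

open import Level using (0ℓ)
open import Data.Nat using (ℕ)
open import Data.Fin using (Fin; _<_; _>_)
open import Data.Product using (_×_)
open import Data.Sum using (_⊎_)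
open import Relation.Nullary using (¬_)
open import Relation.Binary.PropositionalEquality using (_≡_; _≢_)
open import Relation.Binary.Core using (Rel)
import Data.Fin.Permutation.Components as PC

-- A finite simple graph whose vertex set has been identified with [n] = Fin n
-- via a labeling: an irreflexive, symmetric edge relation on Fin n.
record Graph (n : ℕ) : Set₁ where
  field
    Edge      : Rel (Fin n) 0ℓ
    irrefl    : ∀ {i} → ¬ Edge i i
    symmetric : ∀ {i j} → Edge i j → Edge j i
open Graph public

Closed : ∀ {n} → Graph n → Set
Closed {n} G = ∀ (i j k : Fin n) → Edge G j i → Edge G i k → j ≢ k →
  ((j > i × i < k) ⊎ (j < i × i > k)) → Edge G j k

InClosedNbhd : ∀ {n} → Graph n → Fin n → Fin n → Set
InClosedNbhd G v w = (w ≡ v) ⊎ Edge G v w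

Exchangeable : ∀ {n} → Graph n → Fin n → Fin n → Set
Exchangeable {n} G v w = ∀ (x : Fin n) →
  (InClosedNbhd G v x → InClosedNbhd G w x) × (InClosedNbhd G w x → InClosedNbhd G v x)

-- The graph with the same vertices, relabeled by composing the labeling
-- with the transposition (i j): vertex with old label x gets label τ x,
-- so new labels a, b are adjacent iff old labels τ a, τ b are adjacent.
relabel-transpose : ∀ {n} → Graph n → Fin n → Fin n → Graph n
relabel-transpose G i j = record
  { Edge      = λ a b → Edge G (PC.transpose i j a) (PC.transpose i j b)
  ; irrefl    = irrefl G
  ; symmetric = symmetric G
  }

-- Exchangeable vertices i, j have the same closed neighbourhoods, so the
-- transposition (i j) is an automorphism of G. Relabeling by it therefore
-- leaves the edge relation unchanged, and closedness is a property of the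
-- edge relation alone.
module Submission where

open import Defs
open import Data.Nat using (ℕ)
open import Data.Fin using (Fin; _≟_)
open import Data.Fin.Permutation.Components using (transpose; transpose-inverse)
open import Data.Product using (_,_; proj₁; swap)
open import Data.Sum using (inj₁; inj₂)
open import Data.Empty using (⊥-elim)
open import Relation.Nullary using (yes; no)
open import Relation.Binary.Core using (_⇒_; _⇔_)
open import Relation.Binary.PropositionalEquality using (_≡_; _≢_; refl; subst₂)

module _ {n : ℕ} where

  closed-resp-⇔ : {G H : Graph n} → Edge G ⇔ Edge H → Closed G → Closed H
  closed-resp-⇔ (G⇒H , H⇒G) closed i j k eji eik j≢k order =
    G⇒H (closed i j k (H⇒G eji) (H⇒G eik) j≢k order)

  data TransposeView (i j x : Fin n) : Fin n → Set where
    at-i  : x ≡ i → TransposeView i j x j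
    at-j  : x ≡ j → TransposeView i j x i
    fixed : x ≢ i → x ≢ j → TransposeView i j x x

  transpose-view : ∀ i j x → TransposeView i j x (transpose i j x)
  transpose-view i j x with x ≟ i
  ... | yes x≡i = at-i x≡i
  ... | no x≢i with x ≟ j
  ...   | yes x≡j = at-j x≡j
  ...   | no x≢j = fixed x≢i x≢j

  module _ (G : Graph n) where

    exchangeable-sym : ∀ {i j} → Exchangeable G i j → Exchangeable G j i
    exchangeable-sym ex x = swap (ex x)

    exchange-edgeˡ : ∀ {i j y} → Exchangeable G i j → y ≢ j → Edge G i y → Edge G j y
    exchange-edgeˡ ex y≢j e with proj₁ (ex _) (inj₂ e)
    ... | inj₁ y≡j = ⊥-elim (y≢j y≡j)
    ... | inj₂ e′  = e′

    exchange-edgeʳ : ∀ {i j y} → Exchangeable G i j → y ≢ j → Edge G y i → Edge G y j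
    exchange-edgeʳ ex y≢j e = symmetric G (exchange-edgeˡ ex y≢j (symmetric G e))

    transpose-preserves-edge : ∀ {i j} → Exchangeable G i j →
      Edge G ⇒ (λ x y → Edge G (transpose i j x) (transpose i j y))
    transpose-preserves-edge {i} {j} ex {x} {y} e =
      preserve (transpose-view i j x) (transpose-view i j y) e
      where
      ex′ : Exchangeable G j i
      ex′ = exchangeable-sym ex

      preserve : ∀ {x y x′ y′} → TransposeView i j x x′ → TransposeView i j y y′ →
                 Edge G x y → Edge G x′ y′
      preserve (at-i refl)   (at-i refl)   e = ⊥-elim (irrefl G e)
      preserve (at-i refl)   (at-j refl)   e = symmetric G e
      preserve (at-i refl)   (fixed _ y≢j) e = exchange-edgeˡ ex y≢j e
      preserve (at-j refl)   (at-i refl)   e = symmetric G e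
      preserve (at-j refl)   (at-j refl)   e = ⊥-elim (irrefl G e)
      preserve (at-j refl)   (fixed y≢i _) e = exchange-edgeˡ ex′ y≢i e
      preserve (fixed _ x≢j) (at-i refl)   e = exchange-edgeʳ ex x≢j e
      preserve (fixed x≢i _) (at-j refl)   e = exchange-edgeʳ ex′ x≢i e
      preserve (fixed _ _)   (fixed _ _)   e = e

    transpose-reflects-edge : ∀ {i j} → Exchangeable G i j →
      (λ x y → Edge G (transpose i j x) (transpose i j y)) ⇒ Edge G
    transpose-reflects-edge {i} {j} ex e =
      subst₂ (Edge G) (transpose-inverse j i) (transpose-inverse j i)
        (transpose-preserves-edge (exchangeable-sym ex) e)

proposition3p2 : ∀ {n : ℕ} (G : Graph n) (i j : Fin n) →
    Closed G → i ≢ j → Exchangeable G i j → Closed (relabel-transpose G i j)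
proposition3p2 G i j closed _ ex =
  closed-resp-⇔ {G = G} {H = relabel-transpose G i j}
    (transpose-preserves-edge G ex , transpose-reflects-edge G ex) closed
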